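{- Let $n\ge 3$ and $0\le k\le n-2$ be integers, and let $d>1$ be a divisor of $2^{n-k}-1$. Set $X=\{2^n-2^j : k\le j\le n\}$, $m=(2^{n+1}+d)+(2^n-2^k)$, $Y=m-X=\{m-x: x\in X\}$, $Z=\{2^n+jd : 1\le j\le (2^n-2^k)/d\}$, $B=X\sqcup Y\sqcup Z$, $a=2^n$, and $A=B\cup\{a\}$. Then $A$ is a normalised set with $|A+A|=|A-A|+1$ (in particular $|A+A|>|A-A|$).
   Context: For $A\subseteq\mathbb{Z}$, $A+A=\{a_1+a_2 : a_1,a_2\in A\}$ and $A-A=\{a_1-a_2 : a_1,a_2\in A\}$. A finite set $A\subseteq\mathbb{Z}$ is normalised if its smallest element is $0$ and the greatest common divisor of its elements is $1$. -}

module Defs where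

open import Data.Nat as ℕ using (ℕ; suc; _^_; _∸_; NonZero)
open import Data.Nat.DivMod using (_/_)
open import Data.Nat.GCD using (gcd)
open import Data.Integer as ℤ using (ℤ; +_; ∣_∣)
open import Data.List using (List; length; map; upTo; deduplicate; cartesianProductWith; foldr; _++_; [_])
open import Data.List.Membership.Propositional using (_∈_)
open import Data.List.Relation.Unary.All using (All)
open import Data.Product using (_×_)
open import Relation.Binary.PropositionalEquality using (_≡_)

-- Finite sets of integers are represented by lists (duplicates allowed);
-- the cardinality |A| is the number of distinct entries.
card : List ℤ → ℕ
card xs = length (deduplicate ℤ._≟_ xs)

sumset : List ℤ → List ℤ
sumset A = cartesianProductWith ℤ._+_ A A

diffset : List ℤ → List ℤ
diffset A = cartesianProductWith ℤ._-_ A A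

-- gcd of all elements (gcd of the empty list is 0)
gcdList : List ℤ → ℕ
gcdList A = foldr (λ a g → gcd ∣ a ∣ g) 0 A

Normalised : List ℤ → Set
Normalised A = (+ 0 ∈ A) × All (ℤ._≤_ (+ 0)) A × gcdList A ≡ 1

-- [a .. b] ⊆ ℕ (empty if b < a)
range : ℕ → ℕ → List ℕ
range a b = map (a ℕ.+_) (upTo (suc b ∸ a))

Xset : ℕ → ℕ → List ℤ
Xset n k = map (λ j → + (2 ^ n ∸ 2 ^ j)) (range k n)

mval : ℕ → ℕ → ℕ → ℕ
mval n k d = (2 ^ (suc n) ℕ.+ d) ℕ.+ (2 ^ n ∸ 2 ^ k)

Yset : ℕ → ℕ → ℕ → List ℤ
Yset n k d = map (λ x → + mval n k d ℤ.- x) (Xset n k)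

Zset : (n k d : ℕ) → .{{NonZero d}} → List ℤ
Zset n k d = map (λ j → + (2 ^ n ℕ.+ j ℕ.* d)) (range 1 ((2 ^ n ∸ 2 ^ k) / d))

Bset : (n k d : ℕ) → .{{NonZero d}} → List ℤ
Bset n k d = Xset n k ++ Yset n k d ++ Zset n k d

Aset : (n k d : ℕ) → .{{NonZero d}} → List ℤ
Aset n k d = Bset n k d ++ [ + (2 ^ n) ]

-- Let B = A ∖ {a}.  B is symmetric about m/2, so every sum b + b′ with b′ ∈ B is the
-- difference b − (m − b′) shifted by m, and every difference u − b with b ∈ B is
-- u + (m − b) − m.  Hence A + A is (A − A) + m plus the single sum 2a, as long as every
-- u − a + m is a sum and 2a − m is not a difference.  For the second, 2a − m = −(d + ℓ) with ℓ = 2ⁿ − 2ᵏ = t d: the blocks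
-- X ⊆ [0, ℓ], Z ∪ {a} ⊆ [2ⁿ, 2ⁿ + ℓ] and Y ⊆ [2ⁿ⁺¹ + d, 2ⁿ⁺¹ + d + ℓ] leave only the
-- steps X → Z and Z → Y, where a gap of d + ℓ would force d ∣ 2ʲ; but d is odd and d > 1.
module Submission where

open import Defs
open import Data.Integer as ℤ using (ℤ; +_; _-_)
open import Data.Integer.Properties as ℤP using ()
open import Data.Integer.Tactic.RingSolver using (solve-∀)
open import Data.List using (List; _∷_; length; map; deduplicate)
open import Data.List.Properties using (length-map)
open import Data.List.Membership.Propositional using (_∈_; _∉_)
open import Data.List.Membership.Propositional.Properties
  using (∈-map⁺; ∈-map⁻; ∈-upTo⁺; ∈-upTo⁻; ∈-++⁺ˡ; ∈-++⁺ʳ; ∈-++⁻; ∈-deduplicate⁺; ∈-deduplicate⁻;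
         ∈-cartesianProductWith⁺; ∈-cartesianProductWith⁻)
open import Data.List.Membership.Propositional.Properties.WithK using (unique∧set⇒bag)
open import Data.List.Relation.Binary.BagAndSetEquality using (∼bag⇒↭)
open import Data.List.Relation.Binary.Permutation.Propositional.Properties using (↭-length)
open import Data.List.Relation.Binary.Subset.Propositional using (_⊆_)
open import Data.List.Relation.Unary.Any using (here; there)
open import Data.List.Relation.Unary.All as All using ()
open import Data.List.Relation.Unary.AllPairs using (_∷_)
open import Data.List.Relation.Unary.Unique.Propositional using (Unique)
open import Data.List.Relation.Unary.Unique.Propositional.Properties using () renaming (map⁺ to unique-map⁺)
open import Data.List.Relation.Unary.Unique.DecPropositional.Properties ℤ._≟_ using (deduplicate-!)
open import Data.Nat using (ℕ; zero; suc; _+_; _∸_; _^_; _*_; _≤_; _<_; s≤s; s≤s⁻¹; z≤n; NonZero)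
open import Data.Nat.Properties as ℕP using ()
import Data.Nat.Tactic.RingSolver as ℕ-Solver
open import Data.Nat.Coprimality using (Coprime; coprime-divisor)
open import Data.Nat.Divisibility using (_∣_; divides; ∣-refl; ∣-trans; ∣1⇒≡1; ∣m∣n⇒∣m+n; ∣m+n∣m⇒∣n; n∣m*n)
open import Data.Nat.DivMod using (_/_; m/n*n≡m)
open import Data.Nat.GCD using (gcd[m,n]∣m; gcd[m,n]∣n)
open import Data.Product using (_×_; _,_; proj₁; proj₂; ∃-syntax; ∃₂)
open import Data.Sum using (_⊎_; inj₁; inj₂)
open import Function using (_∘_; mk⇔)
open import Relation.Binary.PropositionalEquality using (_≡_; _≢_; refl; sym; trans; cong; cong₂; subst; module ≡-Reasoning)
open import Relation.Nullary using (¬_)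
open import Algebra.Properties.CommutativeSemigroup ℕP.+-commutativeSemigroup using (xy∙z≈xz∙y; x∙yz≈xz∙y; xy∙z≈zy∙x)

card-≡-length : ∀ {xs u : List ℤ} → Unique u → xs ⊆ u → u ⊆ xs → card xs ≡ length u
card-≡-length {xs} u! xs⊆u u⊆xs = ↭-length (∼bag⇒↭ (unique∧set⇒bag (deduplicate-! xs) u!
  (mk⇔ (xs⊆u ∘ ∈-deduplicate⁻ ℤ._≟_ xs) (∈-deduplicate⁺ ℤ._≟_ ∘ u⊆xs))))

[w+m]-m≡w : ∀ w m → (w ℤ.+ m) - m ≡ w
[w+m]-m≡w = solve-∀

b+c≡[b-[m-c]]+m : ∀ b c m → b ℤ.+ c ≡ (b - (m - c)) ℤ.+ m
b+c≡[b-[m-c]]+m = solve-∀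

b+[m-c]≡[b-c]+m : ∀ b c m → b ℤ.+ (m - c) ≡ (b - c) ℤ.+ m
b+[m-c]≡[b-c]+m = solve-∀

sumset-card≡diffset-card+1 : ∀ (A : List ℤ) {a m : ℤ} → a ∈ A →
  (∀ {b} → b ∈ A → b ≡ a ⊎ m - b ∈ A) →
  (∀ {b} → b ∈ A → b - a ℤ.+ m ∈ sumset A) →
  (a ℤ.+ a) - m ∉ diffset A →
  card (sumset A) ≡ card (diffset A) + 1
sumset-card≡diffset-card+1 A {a} {m} a∈A reflect shift 2a-m∉ = begin
  card (sumset A)        ≡⟨ card-≡-length U! sumset⊆U U⊆sumset ⟩
  length U               ≡⟨ cong suc (length-map (ℤ._+ m) D) ⟩
  suc (card (diffset A)) ≡⟨ ℕP.+-comm 1 _ ⟩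
  card (diffset A) + 1   ∎
  where
  open ≡-Reasoning
  D U : List ℤ
  D = deduplicate ℤ._≟_ (diffset A)
  U = (a ℤ.+ a) ∷ map (ℤ._+ m) D

  diff+m∈U : ∀ {b c} → b ∈ A → c ∈ A → (b - c) ℤ.+ m ∈ U
  diff+m∈U b∈ c∈ = there (∈-map⁺ (ℤ._+ m) (∈-deduplicate⁺ ℤ._≟_ (∈-cartesianProductWith⁺ _-_ b∈ c∈)))

  sumset⊆U : sumset A ⊆ U
  sumset⊆U z∈ with ∈-cartesianProductWith⁻ ℤ._+_ A A z∈
  ... | b , c , b∈ , c∈ , refl with reflect c∈ | reflect b∈
  ... | inj₂ m-c∈ | _ = subst (_∈ U) (sym (b+c≡[b-[m-c]]+m b c m)) (diff+m∈U b∈ m-c∈)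
  ... | inj₁ refl | inj₂ m-b∈ = subst (_∈ U) (trans (sym (b+c≡[b-[m-c]]+m c b m)) (ℤP.+-comm c b)) (diff+m∈U c∈ m-b∈)
  ... | inj₁ refl | inj₁ refl = here refl

  U⊆sumset : U ⊆ sumset A
  U⊆sumset (here refl) = ∈-cartesianProductWith⁺ ℤ._+_ a∈A a∈A
  U⊆sumset (there w+m∈) with ∈-map⁻ (ℤ._+ m) w+m∈
  ... | w , w∈ , refl with ∈-cartesianProductWith⁻ _-_ A A (∈-deduplicate⁻ ℤ._≟_ (diffset A) w∈)
  ... | b , c , b∈ , c∈ , refl with reflect c∈
  ... | inj₁ refl = shift b∈
  ... | inj₂ m-c∈ = subst (_∈ sumset A) (b+[m-c]≡[b-c]+m b c m) (∈-cartesianProductWith⁺ ℤ._+_ b∈ m-c∈)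

  2a∉shifted : ∀ {y} → y ∈ map (ℤ._+ m) D → a ℤ.+ a ≢ y
  2a∉shifted y∈ 2a≡w+m with ∈-map⁻ (ℤ._+ m) y∈
  ... | w , w∈ , refl = 2a-m∉ (subst (_∈ diffset A) (trans (sym ([w+m]-m≡w w m)) (cong (_- m) (sym 2a≡w+m)))
                                      (∈-deduplicate⁻ ℤ._≟_ (diffset A) w∈))

  U! : Unique U
  U! = All.tabulate 2a∉shifted ∷ unique-map⁺ +m-injective (deduplicate-! (diffset A))
    where +m-injective : ∀ {w w′} → w ℤ.+ m ≡ w′ ℤ.+ m → w ≡ w′
          +m-injective {w} {w′} e = trans (sym ([w+m]-m≡w w m)) (trans (cong (_- m) e) ([w+m]-m≡w w′ m))

+[m+n]-+m≡+n : ∀ m n → + (m + n) - + m ≡ + n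
+[m+n]-+m≡+n m n = trans (cong (_- + m) (ℤP.pos-+ m n)) (cancel (+ m) (+ n))
  where cancel : ∀ a b → (a ℤ.+ b) - a ≡ b
        cancel = solve-∀

+x-+n++[n+c]≡+[x+c] : ∀ x n c → + x - + n ℤ.+ + (n + c) ≡ + (x + c)
+x-+n++[n+c]≡+[x+c] x n c rewrite ℤP.pos-+ n c | ℤP.pos-+ x c = cancel (+ x) (+ n) (+ c)
  where cancel : ∀ a b e → a - b ℤ.+ (b ℤ.+ e) ≡ a ℤ.+ e
        cancel = solve-∀

+[2n]-+[2n+s]≡+x-+y⇒y≡x+s : ∀ x y n s → (+ n ℤ.+ + n) - + (n + (n + s)) ≡ + x - + y → y ≡ x + s
+[2n]-+[2n+s]≡+x-+y⇒y≡x+s x y n s e rewrite ℤP.pos-+ n (n + s) | ℤP.pos-+ n s = ℤP.+-injective (begin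
  + y                                             ≡⟨ undo (+ x) (+ y) ⟩
  + x - (+ x - + y)                               ≡⟨ cong (+ x -_) (sym e) ⟩
  + x - ((+ n ℤ.+ + n) - (+ n ℤ.+ (+ n ℤ.+ + s))) ≡⟨ simplify (+ x) (+ n) (+ s) ⟩
  + x ℤ.+ + s                                     ≡⟨ sym (ℤP.pos-+ x s) ⟩
  + (x + s)                                       ∎)
  where
  open ≡-Reasoning
  undo : ∀ a b → b ≡ a - (a - b)
  undo = solve-∀
  simplify : ∀ a n s → a - ((n ℤ.+ n) - (n ℤ.+ (n ℤ.+ s))) ≡ a ℤ.+ s
  simplify = solve-∀

∈-range⁻ : ∀ {a b j} → j ∈ range a b → a ≤ j × j ≤ b
∈-range⁻ {a} {b} j∈ with ∈-map⁻ (_+_ a) j∈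
... | i , i∈ , refl = ℕP.m≤m+n a i , ≤-bound a b (∈-upTo⁻ i∈)
  where
  ≤-bound : ∀ a b {i} → i < suc b ∸ a → a + i ≤ b
  ≤-bound zero          b       i<1+b = s≤s⁻¹ i<1+b
  ≤-bound (suc zero)    zero    ()
  ≤-bound (suc (suc a)) zero    ()
  ≤-bound (suc a)       (suc b) i<1+b = s≤s (≤-bound a b i<1+b)

∈-range⁺ : ∀ {a b j} → a ≤ j → j ≤ b → j ∈ range a b
∈-range⁺ {a} {b} {j} a≤j j≤b =
  subst (_∈ range a b) (ℕP.m+[n∸m]≡n a≤j) (∈-map⁺ (_+_ a) (∈-upTo⁺ (<-bound a≤j j≤b)))
  where
  <-bound : ∀ {a b j} → a ≤ j → j ≤ b → j ∸ a < suc b ∸ a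
  <-bound {b = b} z≤n     j≤b       = s≤s j≤b
  <-bound         (s≤s a≤j) (s≤s j≤b) = <-bound a≤j j≤b

gcdList∣ : ∀ {xs z} → z ∈ xs → gcdList xs ∣ ℤ.∣ z ∣
gcdList∣ {x ∷ xs} (here refl) = gcd[m,n]∣m ℤ.∣ x ∣ (gcdList xs)
gcdList∣ {x ∷ xs} (there z∈)  = ∣-trans (gcd[m,n]∣n ℤ.∣ x ∣ (gcdList xs)) (gcdList∣ z∈)

∣2^e∸1⇒coprime-2 : ∀ {m e} → 0 < e → m ∣ 2 ^ e ∸ 1 → Coprime m 2
∣2^e∸1⇒coprime-2 {e = suc e} _ m∣2^e∸1 {i} (i∣m , i∣2) =
  ∣1⇒≡1 (∣m+n∣m⇒∣n (subst (i ∣_) (sym (ℕP.m∸n+n≡m (ℕP.m^n>0 2 (suc e)))) i∣2^[1+e]) (∣-trans i∣m m∣2^e∸1))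
  where
  i∣2^[1+e] : i ∣ 2 ^ suc e
  i∣2^[1+e] = ∣-trans i∣2 (divides (2 ^ e) (ℕP.*-comm 2 (2 ^ e)))

coprime-2^ : ∀ {m} → Coprime m 2 → ∀ j → Coprime m (2 ^ j)
coprime-2^ m⊥2 zero    (_ , i∣1) = ∣1⇒≡1 i∣1
coprime-2^ m⊥2 (suc j) (i∣m , i∣2*2^j) =
  coprime-2^ m⊥2 j (i∣m , coprime-divisor (λ (p , q) → m⊥2 (∣-trans p i∣m , q)) i∣2*2^j)

module Construction (n k d : ℕ) .{{_ : NonZero d}} (k<n : k < n) (1<d : 1 < d)
                    (d∣2^[n∸k]∸1 : d ∣ 2 ^ (n ∸ k) ∸ 1) where

  N K ℓ t s c : ℕ
  N = 2 ^ n
  K = 2 ^ k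
  ℓ = N ∸ K
  t = ℓ / d
  s = d + ℓ
  c = N + s

  k≤n : k ≤ n
  k≤n = ℕP.<⇒≤ k<n

  0<d : 0 < d
  0<d = ℕP.<-trans (s≤s z≤n) 1<d

  2^j≤N : ∀ {j} → j ≤ n → 2 ^ j ≤ N
  2^j≤N = ℕP.^-monoʳ-≤ 2

  N∸2^j+2^j≡N : ∀ {j} → j ≤ n → N ∸ 2 ^ j + 2 ^ j ≡ N
  N∸2^j+2^j≡N = ℕP.m∸n+n≡m ∘ 2^j≤N

  ℓ+K≡N : ℓ + K ≡ N
  ℓ+K≡N = N∸2^j+2^j≡N k≤n

  ℓ<N : ℓ < N
  ℓ<N = subst (ℓ <_) ℓ+K≡N (ℕP.m<m+n ℓ (ℕP.m^n>0 2 k))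

  d∣ℓ : d ∣ ℓ
  d∣ℓ = subst (d ∣_) K*[2^[n∸k]∸1]≡ℓ (∣-trans d∣2^[n∸k]∸1 (n∣m*n K))
    where
    open ≡-Reasoning
    K*[2^[n∸k]∸1]≡ℓ : K * (2 ^ (n ∸ k) ∸ 1) ≡ ℓ
    K*[2^[n∸k]∸1]≡ℓ = begin
      K * (2 ^ (n ∸ k) ∸ 1)   ≡⟨ ℕP.*-distribˡ-∸ K (2 ^ (n ∸ k)) 1 ⟩
      K * 2 ^ (n ∸ k) ∸ K * 1 ≡⟨ cong₂ _∸_ (sym (ℕP.^-distribˡ-+-* 2 k (n ∸ k))) (ℕP.*-identityʳ K) ⟩
      2 ^ (k + (n ∸ k)) ∸ K   ≡⟨ cong (λ e → 2 ^ e ∸ K) (ℕP.m+[n∸m]≡n k≤n) ⟩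
      ℓ                       ∎

  t*d≡ℓ : t * d ≡ ℓ
  t*d≡ℓ = m/n*n≡m d∣ℓ

  0<t : 0 < t
  0<t = ℕP.n≢0⇒n>0 λ t≡0 → ℕP.<⇒≢ 0<ℓ (trans (sym (cong (_* d) t≡0)) t*d≡ℓ)
    where
    0<ℓ : 0 < ℓ
    0<ℓ = ℕP.m<n⇒0<n∸m (ℕP.^-monoʳ-< 2 (s≤s (s≤s z≤n)) k<n)

  d⊥2 : Coprime d 2
  d⊥2 = ∣2^e∸1⇒coprime-2 (ℕP.m<n⇒0<n∸m k<n) d∣2^[n∸k]∸1

  d∤2^j : ∀ j → ¬ d ∣ 2 ^ j
  d∤2^j j d∣2^j = ℕP.<⇒≢ 1<d (sym (coprime-2^ d⊥2 j (∣-refl , d∣2^j)))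

  -- Member x ⇔ + x ∈ A, block by block: X = {N − 2ʲ}, Y = m − X = {c + 2ʲ} with
  -- m = N + c, and Z ∪ {a} = {N + i d : 0 ≤ i ≤ t}, where a = N is i = 0.
  data Member : ℕ → Set where
    X : ∀ {j x} → k ≤ j → j ≤ n → x + 2 ^ j ≡ N → Member x
    Y : ∀ {j} → k ≤ j → j ≤ n → Member (c + 2 ^ j)
    Z : ∀ {i} → i ≤ t → Member (N + i * d)

  ℓ<s : ℓ < s
  ℓ<s = ℕP.m<n+m ℓ 0<d

  X-bound : ∀ {j x} → k ≤ j → x + 2 ^ j ≡ N → x ≤ ℓ
  X-bound {j} {x} k≤j x+2^j≡N = ℕP.+-cancelʳ-≤ K x ℓ (begin
    x + K     ≤⟨ ℕP.+-monoʳ-≤ x (ℕP.^-monoʳ-≤ 2 k≤j) ⟩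
    x + 2 ^ j ≡⟨ x+2^j≡N ⟩
    N         ≡⟨ sym ℓ+K≡N ⟩
    ℓ + K     ∎)
    where open ℕP.≤-Reasoning

  Z-bound : ∀ {i} → i ≤ t → N + i * d ≤ N + ℓ
  Z-bound {i} i≤t = ℕP.+-monoʳ-≤ N (subst (i * d ≤_) t*d≡ℓ (ℕP.*-monoˡ-≤ d i≤t))

  Member≤c+N : ∀ {x} → Member x → x ≤ c + N
  Member≤c+N (X k≤j _ x+2^j≡N) = ℕP.≤-trans (X-bound k≤j x+2^j≡N) (ℕP.≤-trans ℓ≤c (ℕP.m≤m+n c N))
    where ℓ≤c : ℓ ≤ c
          ℓ≤c = ℕP.≤-trans (ℕP.<⇒≤ ℓ<s) (ℕP.m≤n+m s N)
  Member≤c+N (Y _ j≤n) = ℕP.+-monoʳ-≤ c (2^j≤N j≤n)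
  Member≤c+N (Z i≤t) = ℕP.≤-trans (Z-bound i≤t) (ℕP.≤-trans (ℕP.+-monoʳ-≤ N (ℕP.<⇒≤ ℓ<s)) (ℕP.m≤m+n c N))

  y≢x+s : ∀ {x y} → Member x → Member y → y ≢ x + s
  y≢x+s {x} {y} _ (X k≤j _ y+2^j≡N) = ℕP.<⇒≢ (begin-strict
    y     ≤⟨ X-bound k≤j y+2^j≡N ⟩
    ℓ     <⟨ ℓ<s ⟩
    s     ≤⟨ ℕP.m≤n+m s x ⟩
    x + s ∎)
    where open ℕP.≤-Reasoning
  y≢x+s {y = y} (Y {j} k≤j _) my = ℕP.<⇒≢ (begin-strict
    y               ≤⟨ Member≤c+N my ⟩
    c + N           <⟨ ℕP.m<m+n (c + N) 0<d ⟩
    c + N + d       ≡⟨ cong (λ w → c + w + d) (sym ℓ+K≡N) ⟩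
    c + (ℓ + K) + d ≡⟨ rearrange c ℓ K d ⟩
    c + K + s       ≤⟨ ℕP.+-monoˡ-≤ s (ℕP.+-monoʳ-≤ c (ℕP.^-monoʳ-≤ 2 k≤j)) ⟩
    c + 2 ^ j + s   ∎)
    where
    open ℕP.≤-Reasoning
    rearrange : ∀ c ℓ K d → c + (ℓ + K) + d ≡ c + K + (d + ℓ)
    rearrange = ℕ-Solver.solve-∀
  y≢x+s {x} (X k≤j _ x+2^j≡N) (Y {j} _ _) = ℕP.>⇒≢ (begin-strict
    x + s     ≤⟨ ℕP.+-monoˡ-≤ s (X-bound k≤j x+2^j≡N) ⟩
    ℓ + s     <⟨ ℕP.+-monoˡ-< s ℓ<N ⟩
    c         ≤⟨ ℕP.m≤m+n c (2 ^ j) ⟩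
    c + 2 ^ j ∎)
    where open ℕP.≤-Reasoning
  y≢x+s (Z {i} _) (Z {i′} i′≤t) = ℕP.<⇒≢ (begin-strict
    N + i′ * d    ≤⟨ Z-bound i′≤t ⟩
    N + ℓ         <⟨ ℕP.+-monoʳ-< N ℓ<s ⟩
    N + s         ≤⟨ ℕP.+-monoˡ-≤ s (ℕP.m≤m+n N (i * d)) ⟩
    N + i * d + s ∎)
    where open ℕP.≤-Reasoning
  y≢x+s {x} (X {j} _ _ x+2^j≡N) (Z {i} _) N+id≡x+s =
    d∤2^j j (∣m+n∣m⇒∣n (subst (d ∣_) (sym id+2^j≡s) (∣m∣n⇒∣m+n ∣-refl d∣ℓ)) (n∣m*n i))
    where
    open ≡-Reasoning
    id+2^j≡s : i * d + 2 ^ j ≡ s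
    id+2^j≡s = ℕP.+-cancelˡ-≡ N _ _ (begin
      N + (i * d + 2 ^ j) ≡⟨ sym (ℕP.+-assoc N (i * d) (2 ^ j)) ⟩
      N + i * d + 2 ^ j   ≡⟨ cong (_+ 2 ^ j) N+id≡x+s ⟩
      x + s + 2 ^ j       ≡⟨ xy∙z≈xz∙y x s (2 ^ j) ⟩
      x + 2 ^ j + s       ≡⟨ cong (_+ s) x+2^j≡N ⟩
      N + s               ∎)
  y≢x+s (Z {i} _) (Y {j} _ _) c+2^j≡N+id+s =
    d∤2^j j (subst (d ∣_) (sym (ℕP.+-cancelˡ-≡ c _ _ (trans c+2^j≡N+id+s (xy∙z≈xz∙y N (i * d) s)))) (n∣m*n i))

  Member-reflect : ∀ {x} → Member x → x ≡ N ⊎ ∃[ y ] Member y × x + y ≡ N + c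
  Member-reflect {x} (X {j} k≤j j≤n x+2^j≡N) =
    inj₂ (c + 2 ^ j , Y k≤j j≤n , trans (x∙yz≈xz∙y x c (2 ^ j)) (cong (_+ c) x+2^j≡N))
  Member-reflect (Y {j} k≤j j≤n) =
    inj₂ (N ∸ 2 ^ j , X k≤j j≤n (N∸2^j+2^j≡N j≤n) ,
          trans (xy∙z≈zy∙x c (2 ^ j) (N ∸ 2 ^ j)) (cong (_+ c) (N∸2^j+2^j≡N j≤n)))
  Member-reflect (Z {zero} _) = inj₁ (ℕP.+-identityʳ N)
  Member-reflect (Z {suc i} 1+i≤t) = inj₂ (N + (t ∸ i) * d , Z (ℕP.m∸n≤m t i) , (begin
    N + (d + i * d) + (N + (t ∸ i) * d)   ≡⟨ rearrange N d (i * d) ((t ∸ i) * d) ⟩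
    N + (N + (d + (i * d + (t ∸ i) * d))) ≡⟨ cong (λ w → N + (N + (d + w))) id+[t∸i]d≡ℓ ⟩
    N + c                                 ∎))
    where
    open ≡-Reasoning
    rearrange : ∀ N d a b → N + (d + a) + (N + b) ≡ N + (N + (d + (a + b)))
    rearrange = ℕ-Solver.solve-∀
    id+[t∸i]d≡ℓ : i * d + (t ∸ i) * d ≡ ℓ
    id+[t∸i]d≡ℓ = begin
      i * d + (t ∸ i) * d ≡⟨ sym (ℕP.*-distribʳ-+ d i (t ∸ i)) ⟩
      (i + (t ∸ i)) * d   ≡⟨ cong (_* d) (ℕP.m+[n∸m]≡n (ℕP.<⇒≤ 1+i≤t)) ⟩
      t * d               ≡⟨ t*d≡ℓ ⟩
      ℓ                   ∎

  Member-sum : ∀ {x} → Member x → ∃₂ λ y z → Member y × Member z × y + z ≡ x + c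
  Member-sum {x} (X {j} k≤j j≤n x+2^j≡N) with ℕP.m≤n⇒m<n∨m≡n j≤n
  ... | inj₁ j<n = c + 2 ^ j , x′ , Y k≤j j≤n , X (ℕP.m≤n⇒m≤1+n k≤j) j<n (N∸2^j+2^j≡N j<n) ,
                   trans (xy∙z≈zy∙x c (2 ^ j) x′) (cong (_+ c) (sym x≡x′+2^j))
    where
    x′ : ℕ
    x′ = N ∸ 2 ^ suc j
    x≡x′+2^j : x ≡ x′ + 2 ^ j
    x≡x′+2^j = ℕP.+-cancelʳ-≡ (2 ^ j) x (x′ + 2 ^ j)
      (trans x+2^j≡N (trans (sym (N∸2^j+2^j≡N j<n)) (double x′ (2 ^ j))))
      where double : ∀ a p → a + 2 * p ≡ a + p + p
            double = ℕ-Solver.solve-∀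
  ... | inj₂ refl = N + 1 * d , ℓ , Z 0<t , X ℕP.≤-refl k≤n ℓ+K≡N ,
                    trans (rearrange N d ℓ) (cong (_+ c) (sym x≡0))
    where x≡0 : x ≡ 0
          x≡0 = ℕP.+-cancelʳ-≡ N x 0 x+2^j≡N
          rearrange : ∀ N d ℓ → N + 1 * d + ℓ ≡ 0 + (N + (d + ℓ))
          rearrange = ℕ-Solver.solve-∀
  Member-sum (Y {j} k≤j j≤n) with ℕP.m≤n⇒m<n∨m≡n k≤j
  Member-sum (Y {suc j} _ 1+j≤n) | inj₁ (s≤s k≤j) =
    c + 2 ^ j , c + 2 ^ j , Y k≤j j≤n , Y k≤j j≤n , rearrange c (2 ^ j)
    where j≤n : j ≤ n
          j≤n = ℕP.<⇒≤ 1+j≤n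
          rearrange : ∀ c p → c + p + (c + p) ≡ c + 2 * p + c
          rearrange = ℕ-Solver.solve-∀
  Member-sum (Y _ _) | inj₂ refl = c + N , N + 1 * d , Y k≤n ℕP.≤-refl , Z 0<t , (begin
    c + N + (N + 1 * d)       ≡⟨ cong (λ w → c + w + (N + 1 * d)) (sym ℓ+K≡N) ⟩
    c + (ℓ + K) + (N + 1 * d) ≡⟨ rearrange c ℓ K N d ⟩
    c + K + c                 ∎)
    where open ≡-Reasoning
          rearrange : ∀ c ℓ K N d → c + (ℓ + K) + (N + 1 * d) ≡ c + K + (N + (d + ℓ))
          rearrange = ℕ-Solver.solve-∀
  Member-sum (Z {i} i≤t) with ℕP.m≤n⇒m<n∨m≡n i≤t
  ... | inj₁ i<t = N + suc i * d , N + t * d , Z i<t , Z ℕP.≤-refl ,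
                   trans (cong (λ w → N + suc i * d + (N + w)) t*d≡ℓ) (rearrange N d (i * d) ℓ)
    where rearrange : ∀ N d a ℓ → N + (d + a) + (N + ℓ) ≡ N + a + (N + (d + ℓ))
          rearrange = ℕ-Solver.solve-∀
  ... | inj₂ refl = c + N , ℓ , Y k≤n ℕP.≤-refl , X ℕP.≤-refl k≤n ℓ+K≡N ,
                    trans (rearrange c N ℓ) (cong (λ w → N + w + c) (sym t*d≡ℓ))
    where rearrange : ∀ c N ℓ → c + N + ℓ ≡ N + ℓ + c
          rearrange = ℕ-Solver.solve-∀

  mval≡N+c : mval n k d ≡ N + c
  mval≡N+c = rearrange N d ℓ
    where rearrange : ∀ N d ℓ → 2 * N + d + ℓ ≡ N + (N + (d + ℓ))
          rearrange = ℕ-Solver.solve-∀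

  Yset-value : ∀ {j} → j ≤ n → + mval n k d - + (N ∸ 2 ^ j) ≡ + (c + 2 ^ j)
  Yset-value {j} j≤n =
    trans (cong (λ w → + w - + (N ∸ 2 ^ j)) mval≡x+[c+2^j]) (+[m+n]-+m≡+n (N ∸ 2 ^ j) (c + 2 ^ j))
    where
    mval≡x+[c+2^j] : mval n k d ≡ N ∸ 2 ^ j + (c + 2 ^ j)
    mval≡x+[c+2^j] = trans mval≡N+c (trans (cong (_+ c) (sym (N∸2^j+2^j≡N j≤n)))
                                           (sym (x∙yz≈xz∙y (N ∸ 2 ^ j) c (2 ^ j))))

  A : List ℤ
  A = Aset n k d

  N∈A : + N ∈ A
  N∈A = ∈-++⁺ʳ (Bset n k d) (here refl)

  ∈Xset⁻ : ∀ {z} → z ∈ Xset n k → ∃[ j ] k ≤ j × j ≤ n × z ≡ + (N ∸ 2 ^ j)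
  ∈Xset⁻ z∈X with ∈-map⁻ (λ j → + (N ∸ 2 ^ j)) z∈X
  ... | j , j∈ , refl = j , ∈-range⁻ j∈ .proj₁ , ∈-range⁻ j∈ .proj₂ , refl

  ∈Xset⁺ : ∀ {j} → k ≤ j → j ≤ n → + (N ∸ 2 ^ j) ∈ Xset n k
  ∈Xset⁺ k≤j j≤n = ∈-map⁺ (λ j → + (N ∸ 2 ^ j)) (∈-range⁺ k≤j j≤n)

  ∈A⇒Member : ∀ {z} → z ∈ A → ∃[ x ] z ≡ + x × Member x
  ∈A⇒Member z∈A with ∈-++⁻ (Bset n k d) z∈A
  ... | inj₂ (here refl) = N + 0 , cong +_ (sym (ℕP.+-identityʳ N)) , Z z≤n
  ... | inj₁ z∈B with ∈-++⁻ (Xset n k) z∈B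
  ... | inj₁ z∈X with ∈Xset⁻ z∈X
  ...   | j , k≤j , j≤n , refl = N ∸ 2 ^ j , refl , X k≤j j≤n (N∸2^j+2^j≡N j≤n)
  ∈A⇒Member z∈A | inj₁ z∈B | inj₂ z∈YZ with ∈-++⁻ (Yset n k d) z∈YZ
  ... | inj₁ z∈Y with ∈-map⁻ (+ mval n k d -_) z∈Y
  ...   | x , x∈X , refl with ∈Xset⁻ x∈X
  ...     | j , k≤j , j≤n , refl = c + 2 ^ j , Yset-value j≤n , Y k≤j j≤n
  ∈A⇒Member z∈A | inj₁ z∈B | inj₂ z∈YZ | inj₂ z∈Z with ∈-map⁻ (λ i → + (N + i * d)) z∈Z
  ... | i , i∈ , refl = N + i * d , refl , Z (∈-range⁻ i∈ .proj₂)

  Member⇒∈A : ∀ {x} → Member x → + x ∈ A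
  Member⇒∈A (X {j} {x} k≤j j≤n x+2^j≡N) =
    ∈-++⁺ˡ (∈-++⁺ˡ (subst (λ w → + w ∈ Xset n k) N∸2^j≡x (∈Xset⁺ k≤j j≤n)))
    where N∸2^j≡x : N ∸ 2 ^ j ≡ x
          N∸2^j≡x = trans (cong (_∸ 2 ^ j) (sym x+2^j≡N)) (ℕP.m+n∸n≡m x (2 ^ j))
  Member⇒∈A (Y k≤j j≤n) =
    ∈-++⁺ˡ (∈-++⁺ʳ (Xset n k) (∈-++⁺ˡ (subst (_∈ Yset n k d) (Yset-value j≤n) (∈-map⁺ _ (∈Xset⁺ k≤j j≤n)))))
  Member⇒∈A (Z {zero} _) = subst (_∈ A) (cong +_ (sym (ℕP.+-identityʳ N))) N∈A
  Member⇒∈A (Z {suc i} 1+i≤t) =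
    ∈-++⁺ˡ (∈-++⁺ʳ (Xset n k) (∈-++⁺ʳ (Yset n k d) (∈-map⁺ (λ i → + (N + i * d)) (∈-range⁺ (s≤s z≤n) 1+i≤t))))

  A-reflect : ∀ {b} → b ∈ A → b ≡ + N ⊎ + mval n k d - b ∈ A
  A-reflect b∈A with ∈A⇒Member b∈A
  ... | x , refl , mx with Member-reflect mx
  ...   | inj₁ x≡N = inj₁ (cong +_ x≡N)
  ...   | inj₂ (y , my , x+y≡N+c) = inj₂ (subst (_∈ A) (sym m-x≡y) (Member⇒∈A my))
    where m-x≡y : + mval n k d - + x ≡ + y
          m-x≡y = trans (cong (λ w → + w - + x) (trans mval≡N+c (sym x+y≡N+c))) (+[m+n]-+m≡+n x y)

  A-shift : ∀ {b} → b ∈ A → b - + N ℤ.+ + mval n k d ∈ sumset A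
  A-shift b∈A with ∈A⇒Member b∈A
  ... | x , refl , mx with Member-sum mx
  ...   | y , z , my , mz , y+z≡x+c = subst (_∈ sumset A) y+z≡x-N+m
            (∈-cartesianProductWith⁺ ℤ._+_ (Member⇒∈A my) (Member⇒∈A mz))
    where
    open ≡-Reasoning
    y+z≡x-N+m : + y ℤ.+ + z ≡ + x - + N ℤ.+ + mval n k d
    y+z≡x-N+m = begin
      + y ℤ.+ + z                ≡⟨ sym (ℤP.pos-+ y z) ⟩
      + (y + z)                  ≡⟨ cong +_ y+z≡x+c ⟩
      + (x + c)                  ≡⟨ sym (+x-+n++[n+c]≡+[x+c] x N c) ⟩
      + x - + N ℤ.+ + (N + c)    ≡⟨ cong (λ w → + x - + N ℤ.+ + w) (sym mval≡N+c) ⟩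
      + x - + N ℤ.+ + mval n k d ∎

  2N-m∉A-A : (+ N ℤ.+ + N) - + mval n k d ∉ diffset A
  2N-m∉A-A w∈ with ∈-cartesianProductWith⁻ _-_ A A w∈
  ... | b , b′ , b∈ , b′∈ , e with ∈A⇒Member b∈ | ∈A⇒Member b′∈
  ...   | x , refl , mx | y , refl , my =
          y≢x+s mx my (+[2n]-+[2n+s]≡+x-+y⇒y≡x+s x y N s
                         (trans (cong (λ w → (+ N ℤ.+ + N) - + w) (sym mval≡N+c)) e))

  A-card : card (sumset A) ≡ card (diffset A) + 1
  A-card = sumset-card≡diffset-card+1 A N∈A A-reflect A-shift 2N-m∉A-A

  A-normalised : Normalised A
  A-normalised = Member⇒∈A (X k≤n ℕP.≤-refl refl) , All.tabulate nonnegative , gcd≡1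
    where
    nonnegative : ∀ {z} → z ∈ A → + 0 ℤ.≤ z
    nonnegative z∈A with ∈A⇒Member z∈A
    ... | _ , refl , _ = ℤ.+≤+ z≤n
    g∣N : gcdList A ∣ N
    g∣N = gcdList∣ N∈A
    g∣d : gcdList A ∣ d
    g∣d = subst (gcdList A ∣_) (ℕP.*-identityˡ d) (∣m+n∣m⇒∣n (gcdList∣ (Member⇒∈A (Z 0<t))) g∣N)
    gcd≡1 : gcdList A ≡ 1
    gcd≡1 = coprime-2^ d⊥2 n (g∣d , g∣N)

theorem2 : (n k d : ℕ) → .{{_ : NonZero d}} → 3 ≤ n → k ≤ n ∸ 2 → 1 < d → d ∣ (2 ^ (n ∸ k) ∸ 1) →
    Normalised (Aset n k d) × card (sumset (Aset n k d)) ≡ card (diffset (Aset n k d)) + 1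
theorem2 n k d 3≤n k≤n∸2 1<d d∣2^[n∸k]∸1 = A-normalised , A-card
  where
  k<n : k < n
  k<n = ℕP.≤-<-trans k≤n∸2 (ℕP.∸-monoʳ-< {o = 0} (s≤s z≤n) (ℕP.<⇒≤ 3≤n))
  open Construction n k d k<n 1<d d∣2^[n∸k]∸1
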